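{- Let $k\le n$ be positive integers and let $G$ be a $k$-chromatic graph of order $n$ with maximum degree $\Delta(G)$. Then for every $x\in\mathbb{N}$, $$\pi(G,x)\le (x)_{\downarrow k}\,(x-1)^{\Delta(G)-(k-1)}\,x^{n-1-\Delta(G)}.$$
   Context: All graphs are finite and simple. $\pi(G,x)$ denotes the chromatic polynomial of $G$ (for $x\in\mathbb{N}$ it counts the proper colourings $V(G)\to\{1,\dots,x\}$). $(x)_{\downarrow k}=x(x-1)\cdots(x-k+1)$ is the falling factorial. A graph is $k$-chromatic if its chromatic number is $k$. -}

module Defs where

open import Data.Nat using (ℕ; zero; suc; _*_; _∸_; _⊔_; _<_)
open import Data.Bool using (Bool; true; false; _∧_; not; if_then_else_)
open import Data.Fin using (Fin; _≟_)
open import Data.List using (List; []; _∷_; map; concatMap; length; foldr; filterᵇ; allFin)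
open import Data.Vec using (Vec; []; _∷_; lookup)
open import Relation.Binary.PropositionalEquality using (_≡_; _≢_)
open import Relation.Nullary using (¬_)
open import Relation.Nullary.Decidable using (⌊_⌋)
open import Data.Product using (∃; _×_)

record Graph (n : ℕ) : Set where
  field
    adj   : Fin n → Fin n → Bool
    sym   : ∀ u v → adj u v ≡ adj v u
    irrefl : ∀ v → adj v v ≡ false
open Graph public

IsProper : ∀ {n x} → Graph n → (Fin n → Fin x) → Set
IsProper G c = ∀ u v → adj G u v ≡ true → c u ≢ c v

Colourable : ∀ {n} → Graph n → ℕ → Set
Colourable {n} G x = ∃ λ (c : Fin n → Fin x) → IsProper G c

Chromatic : ∀ {n} → Graph n → ℕ → Set
Chromatic G k = Colourable G k × (∀ m → m < k → ¬ Colourable G m)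

allColourings : (n x : ℕ) → List (Vec (Fin x) n)
allColourings zero    x = [] ∷ []
allColourings (suc n) x =
  concatMap (λ a → map (λ v → a ∷ v) (allColourings n x)) (allFin x)

properᵇ : ∀ {n x} → Graph n → Vec (Fin x) n → Bool
properᵇ {n} G c =
  foldr _∧_ true
    (concatMap (λ u → map (λ v → not (adj G u v ∧ ⌊ lookup c u ≟ lookup c v ⌋)) (allFin n))
               (allFin n))

π : ∀ {n} → Graph n → ℕ → ℕ
π {n} G x = length (filterᵇ (properᵇ G) (allColourings n x))

deg : ∀ {n} → Graph n → Fin n → ℕ
deg {n} G v = length (filterᵇ (adj G v) (allFin n))

Δ : ∀ {n} → Graph n → ℕ
Δ {n} G = foldr _⊔_ 0 (map (deg G) (allFin n))

_↓_ : ℕ → ℕ → ℕ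
x ↓ zero    = 1
x ↓ suc k   = (x ↓ k) * (x ∸ k)

-- A graph of chromatic number at least j has a vertex of degree at least j − 1, for otherwise
-- greedy colouring uses fewer than j colours. Fix such a vertex v of degree d, and split the
-- colourings from y colours according to the colour a of v and the set I of vertices coloured a:
-- I contains v, misses the neighbourhood of v, and G − I, coloured from the other y − 1 colours,
-- still has chromatic number at least j − 1. By induction on j, G − I has at most
-- (y−1)↓(j−1) · (y−1)^(|G − I| − (j−1)) colourings; summing over the possible intersections of I
-- with the r = |G| − 1 − d non-neighbours of v gives (y−1)↓(j−1) · (y−1)^(d−j+1) · y^r, and the
-- y choices of a give y↓j · (y−1)^(d−j+1) · y^r. Weakening y − 1 to y gives the bound
-- y↓j · y^(|G| − j) that drives the induction; a vertex of maximum degree gives the theorem.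
-- Everything is done for list colourings of vertex subsets, so that G − I is again an instance.

module Submission where

open import Data.Bool using (Bool; true; false; not; _∧_; if_then_else_; T)
open import Data.Bool.Properties using (∧-identityʳ; ∧-zeroʳ; T-≡; T-∧) renaming (_≟_ to _≟ᵇ_)
open import Data.Fin using (Fin; zero; suc; toℕ; fromℕ<)
open import Data.Fin.Properties using (_≟_; all?; any?; ¬∀⟶∃¬; pigeonhole; toℕ<n; toℕ-fromℕ<)
import Data.List as List
open import Data.List using (List; []; _∷_; _++_; length; foldr; map; concatMap; filterᵇ; allFin; tabulate)
open import Data.List.Membership.Propositional using (_∈_; _∉_)
open import Data.List.Membership.Propositional.Properties
  using (∈-map⁺; ∈-filter⁺; ∈-allFin; ∈-∃++; ∈-concat⁺′)
open import Data.List.Properties using (length-map; length-++-sucʳ; length-tabulate; foldr-forcesᵇ)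
open import Data.List.Relation.Unary.All as All using (All)
open import Data.List.Relation.Unary.Any using (here; there; index)
open import Data.List.Relation.Unary.Any.Properties using (lookup-index)
open import Data.Nat using (ℕ; zero; suc; _+_; _*_; _∸_; _^_; _≤_; _<_; _≤?_; _⊔_; z≤n; s≤s)
open import Data.Nat.Properties hiding (_≟_)
open import Data.Nat.Properties using () renaming (_≟_ to _≟ℕ_)
open import Data.Product using (∃; _×_; _,_)
open import Data.Sum using (inj₁; inj₂)
open import Data.Vec using (Vec; []; _∷_; lookup)
open import Data.Vec.Functional using (updateAt)
open import Data.Vec.Functional.Properties using (updateAt-updates; updateAt-minimal)
open import Function using (_∘_; const; Equivalence)
open import Level using (0ℓ)
open import Relation.Binary.Definitions using (DecidableEquality)
open import Relation.Binary.PropositionalEquality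
open import Relation.Nullary using (¬_; yes; no; does; ¬?; _×-dec_; _→-dec_)
open import Relation.Nullary.Decidable using (T?; ⌊_⌋; dec-true; dec-false)
open import Relation.Nullary.Negation using (contradiction)
open import Relation.Unary using (Pred; Decidable)

open import Data.List.Membership.DecPropositional _≟ℕ_ using (_∈?_)
open import Algebra.Properties.CommutativeSemigroup +-commutativeSemigroup
  using () renaming (interchange to +-interchange; x∙yz≈y∙xz to +-exchange)
open import Algebra.Properties.CommutativeMonoid.Sum +-0-commutativeMonoid
  using (sum; sum-cong-≗; ∑-distrib-+; sum-replicate-zero)
open import Algebra.Properties.Monoid.Sum *-1-monoid
  using () renaming (sum to product; sum-cong-≗ to product-cong-≗; sum-replicate-zero to product-ones)

open import Defs hiding (sym)
open import Defs using () renaming (sym to adj-sym)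

-- Arithmetic and finite sums

𝟙 : Bool → ℕ
𝟙 true  = 1
𝟙 false = 0

↓-suc : ∀ x k → x ↓ suc k ≡ x * ((x ∸ 1) ↓ k)
↓-suc zero    k       = trans (cong ((0 ↓ k) *_) (0∸n≡0 k)) (*-zeroʳ (0 ↓ k))
↓-suc (suc x) zero    = trans (+-identityʳ (suc x)) (sym (*-identityʳ (suc x)))
↓-suc (suc x) (suc k) = begin
  (suc x ↓ suc k) * (x ∸ k)    ≡⟨ cong (_* (x ∸ k)) (↓-suc (suc x) k) ⟩
  suc x * (x ↓ k) * (x ∸ k)    ≡⟨ *-assoc (suc x) (x ↓ k) (x ∸ k) ⟩
  suc x * (x ↓ suc k)          ∎
  where open ≡-Reasoning

∧-≡-trueˡ : ∀ {a b} → a ∧ b ≡ true → a ≡ true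
∧-≡-trueˡ {true} _ = refl

pred-base-≤ : ∀ a y e r → a * (y ∸ 1) ^ e * y ^ r ≤ a * y ^ (e + r)
pred-base-≤ a y e r = begin
  a * (y ∸ 1) ^ e * y ^ r    ≤⟨ *-monoˡ-≤ (y ^ r) (*-monoʳ-≤ a (^-monoˡ-≤ e (m∸n≤m y 1))) ⟩
  a * y ^ e * y ^ r          ≡⟨ *-assoc a (y ^ e) (y ^ r) ⟩
  a * (y ^ e * y ^ r)        ≡⟨ cong (a *_) (sym (^-distribˡ-+-* y e r)) ⟩
  a * y ^ (e + r)            ∎
  where open ≤-Reasoning

sum-mono-≤ : ∀ {n} {f g : Fin n → ℕ} → (∀ i → f i ≤ g i) → sum f ≤ sum g
sum-mono-≤ {zero}  f≤g = z≤n
sum-mono-≤ {suc n} f≤g = +-mono-≤ (f≤g zero) (sum-mono-≤ (f≤g ∘ suc))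

sum-𝟙-≟ : ∀ {n} (v : Fin n) → sum (λ i → 𝟙 (does (i ≟ v))) ≡ 1
sum-𝟙-≟ {suc n} zero    = cong suc (sum-replicate-zero n)
sum-𝟙-≟ {suc n} (suc v) = sum-𝟙-≟ v

product-^ : ∀ {n} z (f : Fin n → ℕ) → product (λ i → z ^ f i) ≡ z ^ sum f
product-^ {zero}  z f = refl
product-^ {suc n} z f = trans (cong (z ^ f zero *_) (product-^ z (f ∘ suc)))
                              (sym (^-distribˡ-+-* z (f zero) (sum (f ∘ suc))))

module _ {A : Set} where

  sumMap : (A → ℕ) → List A → ℕ
  sumMap f []       = 0
  sumMap f (x ∷ xs) = f x + sumMap f xs

  sumMap-cong : ∀ {f g : A → ℕ} → (∀ x → f x ≡ g x) → ∀ xs → sumMap f xs ≡ sumMap g xs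
  sumMap-cong f≗g []       = refl
  sumMap-cong f≗g (x ∷ xs) = cong₂ _+_ (f≗g x) (sumMap-cong f≗g xs)

  sumMap-mono-≤ : ∀ {f g : A → ℕ} → (∀ x → f x ≤ g x) → ∀ xs → sumMap f xs ≤ sumMap g xs
  sumMap-mono-≤ f≤g []       = z≤n
  sumMap-mono-≤ f≤g (x ∷ xs) = +-mono-≤ (f≤g x) (sumMap-mono-≤ f≤g xs)

  sumMap-++ : ∀ f xs ys → sumMap f (xs ++ ys) ≡ sumMap f xs + sumMap f ys
  sumMap-++ f []       ys = refl
  sumMap-++ f (x ∷ xs) ys = trans (cong (f x +_) (sumMap-++ f xs ys)) (sym (+-assoc (f x) _ _))

  sumMap-const : ∀ c xs → sumMap (λ _ → c) xs ≡ length xs * c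
  sumMap-const c []       = refl
  sumMap-const c (x ∷ xs) = cong (c +_) (sumMap-const c xs)

  sumMap-*ʳ : ∀ f c xs → sumMap (λ x → f x * c) xs ≡ sumMap f xs * c
  sumMap-*ʳ f c []       = refl
  sumMap-*ʳ f c (x ∷ xs) = trans (cong (f x * c +_) (sumMap-*ʳ f c xs))
                                 (sym (*-distribʳ-+ c (f x) (sumMap f xs)))

  sumMap-≤-length-* : ∀ {f : A → ℕ} {b} xs → (∀ {x} → x ∈ xs → f x ≤ b) → sumMap f xs ≤ length xs * b
  sumMap-≤-length-* []       f≤b = z≤n
  sumMap-≤-length-* (x ∷ xs) f≤b = +-mono-≤ (f≤b (here refl)) (sumMap-≤-length-* xs (f≤b ∘ there))

  sumMap-nonzero : ∀ f xs → sumMap f xs ≢ 0 → ∃ λ x → x ∈ xs × f x ≢ 0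
  sumMap-nonzero f []       ≢0 = contradiction refl ≢0
  sumMap-nonzero f (x ∷ xs) ≢0 with f x ≟ℕ 0
  ... | no  fx≢0 = x , here refl , fx≢0
  ... | yes fx≡0 with sumMap-nonzero f xs (≢0 ∘ trans (cong (_+ sumMap f xs) fx≡0))
  ...   | y , y∈xs , fy≢0 = y , there y∈xs , fy≢0

  sumMap-+ : ∀ f g xs → sumMap (λ x → f x + g x) xs ≡ sumMap f xs + sumMap g xs
  sumMap-+ f g []       = refl
  sumMap-+ f g (x ∷ xs) = trans (cong (f x + g x +_) (sumMap-+ f g xs))
                                (+-interchange (f x) (g x) (sumMap f xs) (sumMap g xs))

module _ {A B : Set} (f : B → ℕ) where

  sumMap-map : ∀ (g : A → B) xs → sumMap f (map g xs) ≡ sumMap (f ∘ g) xs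
  sumMap-map g []       = refl
  sumMap-map g (x ∷ xs) = cong (f (g x) +_) (sumMap-map g xs)

  sumMap-concatMap : ∀ (g : A → List B) xs → sumMap f (concatMap g xs) ≡ sumMap (sumMap f ∘ g) xs
  sumMap-concatMap g []       = refl
  sumMap-concatMap g (x ∷ xs) = trans (sumMap-++ f (g x) (concatMap g xs))
                                      (cong (sumMap f (g x) +_) (sumMap-concatMap g xs))

sumMap-swap : ∀ {A B : Set} (f : A → B → ℕ) xs ys →
  sumMap (λ x → sumMap (f x) ys) xs ≡ sumMap (λ y → sumMap (λ x → f x y) xs) ys
sumMap-swap f []       ys = sym (trans (sumMap-const 0 ys) (*-zeroʳ (length ys)))
sumMap-swap f (x ∷ xs) ys = trans (cong (sumMap (f x) ys +_) (sumMap-swap f xs ys))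
                                  (sym (sumMap-+ (f x) (λ y → sumMap (λ x′ → f x′ y) xs) ys))

length-filterᵇ : ∀ {A : Set} (p : A → Bool) xs → length (filterᵇ p xs) ≡ sumMap (𝟙 ∘ p) xs
length-filterᵇ p []       = refl
length-filterᵇ p (x ∷ xs) with p x
... | true  = cong suc (length-filterᵇ p xs)
... | false = length-filterᵇ p xs

sumMap-tabulate : ∀ {A : Set} {n} (g : A → ℕ) (f : Fin n → A) → sumMap g (tabulate f) ≡ sum (g ∘ f)
sumMap-tabulate {n = zero}  g f = refl
sumMap-tabulate {n = suc n} g f = cong (g (f zero) +_) (sumMap-tabulate g (f ∘ suc))

length-filterᵇ-allFin : ∀ {n} (p : Fin n → Bool) → length (filterᵇ p (allFin n)) ≡ sum (𝟙 ∘ p)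
length-filterᵇ-allFin p = trans (length-filterᵇ p (allFin _)) (sumMap-tabulate (𝟙 ∘ p) (λ i → i))

free-colour : ∀ k (xs : List ℕ) → length xs < k → ∃ λ b → b < k × b ∉ xs
free-colour k xs len<k with all? (λ (b : Fin k) → toℕ b ∈? xs)
... | no ¬all with ¬∀⟶∃¬ k (λ b → toℕ b ∈ xs) (λ b → toℕ b ∈? xs) ¬all
...   | b , b∉ = toℕ b , toℕ<n b , b∉
free-colour k xs len<k | yes all with pigeonhole len<k (λ b → index (all b))
...   | i , j , i<j , same = contradiction i≡j (<⇒≢ i<j)
  where
  i≡j : toℕ i ≡ toℕ j
  i≡j = trans (lookup-index (all i))
              (trans (cong (List.lookup xs) same) (sym (lookup-index (all j))))

module _ {A : Set} (f : A → ℕ) where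

  ≤-max : ∀ {x} xs → x ∈ xs → f x ≤ foldr _⊔_ 0 (map f xs)
  ≤-max (y ∷ ys) (here refl) = m≤m⊔n (f y) _
  ≤-max (y ∷ ys) (there x∈) = ≤-trans (≤-max ys x∈) (m≤n⊔m (f y) _)

  max-attained : ∀ {x} xs → x ∈ xs → ∃ λ y → y ∈ xs × foldr _⊔_ 0 (map f xs) ≡ f y
  max-attained (x ∷ [])         _ = x , here refl , ⊔-identityʳ (f x)
  max-attained (x ∷ xs@(_ ∷ _)) _ with max-attained xs (here refl)
  ... | y , y∈ , max≡fy with ≤-total (f x) (f y)
  ...   | inj₁ fx≤fy = y , there y∈ , trans (cong (f x ⊔_) max≡fy) (m≤n⇒m⊔n≡n fx≤fy)
  ...   | inj₂ fy≤fx = x , here refl , trans (cong (f x ⊔_) max≡fy) (m≥n⇒m⊔n≡m fy≤fx)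

-- Sums over products of lists, and counting

module _ {A : Set} where

  sumΠ : ∀ {n} → (Fin n → List A) → (Vec A n → ℕ) → ℕ
  sumΠ {zero}  As f = f []
  sumΠ {suc n} As f = sumMap (λ a → sumΠ (As ∘ suc) (f ∘ (a ∷_))) (As zero)

  sumΠ-cong : ∀ {n} {As Bs : Fin n → List A} f → (∀ i → As i ≡ Bs i) → sumΠ As f ≡ sumΠ Bs f
  sumΠ-cong {zero}            f As≗Bs = refl
  sumΠ-cong {suc n} {As} {Bs} f As≗Bs =
    trans (cong (sumMap _) (As≗Bs zero))
          (sumMap-cong (λ a → sumΠ-cong (f ∘ (a ∷_)) (As≗Bs ∘ suc)) (Bs zero))

  sumΠ-cong-≗ : ∀ {n} (As : Fin n → List A) {f g} → (∀ c → f c ≡ g c) → sumΠ As f ≡ sumΠ As g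
  sumΠ-cong-≗ {zero}  As f≗g = f≗g []
  sumΠ-cong-≗ {suc n} As f≗g =
    sumMap-cong (λ a → sumΠ-cong-≗ (As ∘ suc) (f≗g ∘ (a ∷_))) (As zero)

  sumΠ-mono-≤ : ∀ {n} (As : Fin n → List A) {f g} → (∀ c → f c ≤ g c) → sumΠ As f ≤ sumΠ As g
  sumΠ-mono-≤ {zero}  As f≤g = f≤g []
  sumΠ-mono-≤ {suc n} As f≤g =
    sumMap-mono-≤ (λ a → sumΠ-mono-≤ (As ∘ suc) (f≤g ∘ (a ∷_))) (As zero)

  sumΠ-*ˡ : ∀ {n} (As : Fin n → List A) k f → sumΠ As (λ c → k * f c) ≡ k * sumΠ As f
  sumΠ-*ˡ {zero}  As k f = refl
  sumΠ-*ˡ {suc n} As k f = begin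
    sumMap (λ a → sumΠ (As ∘ suc) (λ c → k * f (a ∷ c))) (As zero)
      ≡⟨ sumMap-cong (λ a → trans (sumΠ-*ˡ (As ∘ suc) k (f ∘ (a ∷_))) (*-comm k _)) (As zero) ⟩
    sumMap (λ a → sumΠ (As ∘ suc) (f ∘ (a ∷_)) * k) (As zero)
      ≡⟨ sumMap-*ʳ _ k (As zero) ⟩
    sumΠ As f * k
      ≡⟨ *-comm (sumΠ As f) k ⟩
    k * sumΠ As f ∎
    where open ≡-Reasoning

  sumΠ-product : ∀ {n} (As : Fin n → List A) (w : Fin n → A → ℕ) →
    sumΠ As (λ c → product (λ i → w i (lookup c i))) ≡ product (λ i → sumMap (w i) (As i))
  sumΠ-product {zero}  As w = refl
  sumΠ-product {suc n} As w = begin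
    sumMap (λ a → sumΠ (As ∘ suc) (λ c → w zero a * ∏w′ c)) (As zero)
      ≡⟨ sumMap-cong (λ a → sumΠ-*ˡ (As ∘ suc) (w zero a) ∏w′) (As zero) ⟩
    sumMap (λ a → w zero a * sumΠ (As ∘ suc) ∏w′) (As zero)
      ≡⟨ sumMap-*ʳ (w zero) _ (As zero) ⟩
    sumMap (w zero) (As zero) * sumΠ (As ∘ suc) ∏w′
      ≡⟨ cong (sumMap (w zero) (As zero) *_) (sumΠ-product (As ∘ suc) (w ∘ suc)) ⟩
    product (λ i → sumMap (w i) (As i)) ∎
    where
    open ≡-Reasoning
    ∏w′ : Vec A n → ℕ
    ∏w′ c = product (λ i → w (suc i) (lookup c i))

  sumΠ-sumMap : ∀ {B : Set} {n} (As : Fin n → List A) (h : Vec A n → B → ℕ) xs →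
    sumΠ As (λ c → sumMap (h c) xs) ≡ sumMap (λ x → sumΠ As (λ c → h c x)) xs
  sumΠ-sumMap {n = zero}  As h xs = refl
  sumΠ-sumMap {n = suc n} As h xs =
    trans (sumMap-cong (λ a → sumΠ-sumMap (As ∘ suc) (h ∘ (a ∷_)) xs) (As zero))
          (sumMap-swap (λ a x → sumΠ (As ∘ suc) (λ c → h (a ∷ c) x)) (As zero) xs)

  sumΠ-pin : ∀ {n} (As : Fin n → List A) f v →
    sumΠ As f ≡ sumMap (λ a → sumΠ (updateAt As v (const (a ∷ []))) f) (As v)
  sumΠ-pin {suc n} As f zero    = sumMap-cong (λ a → sym (+-identityʳ _)) (As zero)
  sumΠ-pin {suc n} As f (suc v) =
    trans (sumMap-cong (λ a → sumΠ-pin (As ∘ suc) (f ∘ (a ∷_)) v) (As zero))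
          (sumMap-swap (λ a b → sumΠ (updateAt (As ∘ suc) v (const (b ∷ []))) (f ∘ (a ∷_)))
                       (As zero) (As (suc v)))

  sumΠ-witness : ∀ {n} (As : Fin n → List A) f → sumΠ As f ≢ 0 →
    ∃ λ c → (∀ i → lookup c i ∈ As i) × f c ≢ 0
  sumΠ-witness {zero}  As f ≢0 = [] , (λ ()) , ≢0
  sumΠ-witness {suc n} As f ≢0 with sumMap-nonzero _ (As zero) ≢0
  ... | a , a∈ , ≢0′ with sumΠ-witness (As ∘ suc) (f ∘ (a ∷_)) ≢0′
  ...   | c , c∈ , fc≢0 = a ∷ c , (λ { zero → a∈ ; (suc i) → c∈ i }) , fc≢0

module _ {A : Set} where

  parts : ∀ {n} → (Fin n → List A) → (Fin n → A) → (Fin n → List A) → Vec Bool n → Fin n → List A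
  parts Bs a Cs t i = if lookup t i then a i ∷ [] else Bs i ++ Cs i

  sumΠ-parts : ∀ {n} (As Bs Cs : Fin n → List A) (a : Fin n → A) f →
    (∀ i → As i ≡ Bs i ++ a i ∷ Cs i) →
    sumΠ As f ≡ sumΠ (λ _ → true ∷ false ∷ []) (λ t → sumΠ (parts Bs a Cs t) f)
  sumΠ-parts {zero}  As Bs Cs a f As≡ = refl
  sumΠ-parts {suc n} As Bs Cs a f As≡ = begin
    sumMap g (As zero)
      ≡⟨ cong (sumMap g) (As≡ zero) ⟩
    sumMap g (Bs zero ++ a zero ∷ Cs zero)
      ≡⟨ sumMap-++ g (Bs zero) _ ⟩
    sumMap g (Bs zero) + (g (a zero) + sumMap g (Cs zero))
      ≡⟨ +-exchange (sumMap g (Bs zero)) (g (a zero)) _ ⟩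
    g (a zero) + (sumMap g (Bs zero) + sumMap g (Cs zero))
      ≡⟨ cong (g (a zero) +_) (sym (sumMap-++ g (Bs zero) (Cs zero))) ⟩
    g (a zero) + sumMap g (Bs zero ++ Cs zero)
      ≡⟨ cong₂ _+_ (trans (split (a zero)) (sumΠ-cong-≗ 𝔹 (λ t → sym (+-identityʳ _))))
                   (trans (sumMap-cong split (Bs zero ++ Cs zero))
                          (sym (sumΠ-sumMap 𝔹 (λ t x → sumΠ (parts′ t) (f ∘ (x ∷_))) (Bs zero ++ Cs zero)))) ⟩
    sumΠ 𝔹 (λ t → sumΠ (parts Bs a Cs (true ∷ t)) f) + sumΠ 𝔹 (λ t → sumΠ (parts Bs a Cs (false ∷ t)) f)
      ≡⟨ cong (sumΠ 𝔹 (λ t → sumΠ (parts Bs a Cs (true ∷ t)) f) +_) (sym (+-identityʳ _)) ⟩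
    sumΠ (λ _ → true ∷ false ∷ []) (λ t → sumΠ (parts Bs a Cs t) f) ∎
    where
    open ≡-Reasoning
    𝔹 : Fin n → List Bool
    𝔹 _ = true ∷ false ∷ []
    parts′ = parts (Bs ∘ suc) (a ∘ suc) (Cs ∘ suc)
    g : A → ℕ
    g x = sumΠ (As ∘ suc) (f ∘ (x ∷_))
    split : ∀ x → g x ≡ sumΠ 𝔹 (λ t → sumΠ (parts′ t) (f ∘ (x ∷_)))
    split x = sumΠ-parts (As ∘ suc) (Bs ∘ suc) (Cs ∘ suc) (a ∘ suc) (f ∘ (x ∷_)) (As≡ ∘ suc)

count : ∀ {A : Set} {n} {P : Pred (Vec A n) 0ℓ} → (Fin n → List A) → Decidable P → ℕ
count As P? = sumΠ As (λ c → 𝟙 (does (P? c)))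

module _ {A : Set} {n : ℕ} (As : Fin n → List A) where

  count-mono-≤ : ∀ {P Q : Pred (Vec A n) 0ℓ} (P? : Decidable P) (Q? : Decidable Q) →
    (∀ {c} → P c → Q c) → count As P? ≤ count As Q?
  count-mono-≤ P? Q? P⇒Q = sumΠ-mono-≤ As 𝟙-mono
    where
    𝟙-mono : ∀ c → 𝟙 (does (P? c)) ≤ 𝟙 (does (Q? c))
    𝟙-mono c with P? c | Q? c
    ... | no  _  | _     = z≤n
    ... | yes _  | yes _ = ≤-refl
    ... | yes Pc | no ¬Qc = contradiction (P⇒Q Pc) ¬Qc

  count-≤-product : ∀ {P : Pred (Vec A n) 0ℓ} (P? : Decidable P) →
    count As P? ≤ product (λ i → length (As i))
  count-≤-product P? = begin
    count As P?                                   ≤⟨ sumΠ-mono-≤ As 𝟙≤∏1 ⟩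
    sumΠ As (λ c → product (λ (_ : Fin n) → 1))   ≡⟨ sumΠ-product As (λ _ _ → 1) ⟩
    product (λ i → sumMap (λ _ → 1) (As i))       ≡⟨ product-cong-≗ length≡ ⟩
    product (λ i → length (As i))                 ∎
    where
    open ≤-Reasoning
    𝟙≤∏1 : ∀ c → 𝟙 (does (P? c)) ≤ product (λ (_ : Fin n) → 1)
    𝟙≤∏1 c with does (P? c)
    ... | true  = ≤-reflexive (sym (product-ones n))
    ... | false = z≤n
    length≡ : ∀ i → sumMap (λ _ → 1) (As i) ≡ length (As i)
    length≡ i = trans (sumMap-const 1 (As i)) (*-identityʳ _)

  count-≤-witness : ∀ {P : Pred (Vec A n) 0ℓ} (P? : Decidable P) {b} →
    (∀ c → (∀ i → lookup c i ∈ As i) → P c → count As P? ≤ b) → count As P? ≤ b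
  count-≤-witness P? {b} bound with count As P? ≟ℕ 0
  ... | yes ≡0 = subst (_≤ b) (sym ≡0) z≤n
  ... | no  ≢0 with sumΠ-witness As _ ≢0
  ...   | c , c∈ , 𝟙≢0 with P? c
  ...     | yes Pc = bound c c∈ Pc
  ...     | no  _  = contradiction refl 𝟙≢0

sumMap-allColourings : ∀ n x (f : Vec (Fin x) n → ℕ) →
  sumMap f (allColourings n x) ≡ sumΠ (λ _ → allFin x) f
sumMap-allColourings zero    x f = +-identityʳ (f [])
sumMap-allColourings (suc n) x f = begin
  sumMap f (concatMap (λ a → map (a ∷_) (allColourings n x)) (allFin x))
    ≡⟨ sumMap-concatMap f (λ a → map (a ∷_) (allColourings n x)) (allFin x) ⟩
  sumMap (λ a → sumMap f (map (a ∷_) (allColourings n x))) (allFin x)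
    ≡⟨ sumMap-cong (λ a → trans (sumMap-map f (a ∷_) (allColourings n x))
                                (sumMap-allColourings n x (f ∘ (a ∷_)))) (allFin x) ⟩
  sumΠ (λ _ → allFin x) f ∎
  where open ≡-Reasoning


-- Colourings of vertex subsets

module GraphColouring {n : ℕ} (G : Graph n) where

  ∣_∣ : (Fin n → Bool) → ℕ
  ∣ W ∣ = sum (λ i → 𝟙 (W i))

  _─_ : (Fin n → Bool) → Fin n → Fin n → Bool
  (W ─ u) i = W i ∧ not (does (i ≟ u))

  _∩N_ : (Fin n → Bool) → Fin n → Fin n → Bool
  (W ∩N v) i = W i ∧ adj G v i

  degIn : (Fin n → Bool) → Fin n → ℕ
  degIn W v = ∣ W ∩N v ∣

  ∈─ : ∀ {W u i} → W i ≡ true → i ≢ u → (W ─ u) i ≡ true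
  ∈─ {W} {u} {i} Wi i≢u rewrite Wi | dec-false (i ≟ u) i≢u = refl

  ─-self : ∀ {W} u → (W ─ u) u ≡ false
  ─-self {W} u rewrite dec-true (u ≟ u) refl = ∧-zeroʳ (W u)

  ∣∣-remove : ∀ {W u} → W u ≡ true → ∣ W ∣ ≡ suc ∣ W ─ u ∣
  ∣∣-remove {W} {u} Wu = begin
    ∣ W ∣                                                   ≡⟨ sum-cong-≗ split ⟩
    sum (λ i → 𝟙 (does (i ≟ u)) + 𝟙 ((W ─ u) i))           ≡⟨ ∑-distrib-+ (λ i → 𝟙 (does (i ≟ u))) _ ⟩
    sum (λ i → 𝟙 (does (i ≟ u))) + ∣ W ─ u ∣              ≡⟨ cong (_+ ∣ W ─ u ∣) (sum-𝟙-≟ u) ⟩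
    suc ∣ W ─ u ∣                                           ∎
    where
    open ≡-Reasoning
    split : ∀ i → 𝟙 (W i) ≡ 𝟙 (does (i ≟ u)) + 𝟙 ((W ─ u) i)
    split i with i ≟ u
    ... | yes refl rewrite Wu = refl
    ... | no  _    = cong 𝟙 (sym (∧-identityʳ (W i)))

  ∣∣-mono-≤ : ∀ {W W′} → (∀ i → W i ≡ true → W′ i ≡ true) → ∣ W ∣ ≤ ∣ W′ ∣
  ∣∣-mono-≤ {W} {W′} W⊆W′ = sum-mono-≤ 𝟙-mono
    where
    𝟙-mono : ∀ i → 𝟙 (W i) ≤ 𝟙 (W′ i)
    𝟙-mono i with W i in Wi
    ... | false = z≤n
    ... | true  rewrite W⊆W′ i Wi = ≤-refl

  degIn-─ : ∀ W u v → degIn (W ─ u) v ≤ degIn W v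
  degIn-─ W u v = ∣∣-mono-≤ ⊆
    where
    ⊆ : ∀ i → ((W ─ u) i ∧ adj G v i) ≡ true → (W i ∧ adj G v i) ≡ true
    ⊆ i with W i | does (i ≟ u)
    ... | true  | false = λ Nv → Nv
    ... | true  | true  = λ ()
    ... | false | _     = λ ()

  ProperOn : ∀ {Y : Set} → (Fin n → Bool) → (Fin n → Y) → Set
  ProperOn W c = ∀ p q → W p ≡ true → W q ≡ true → adj G p q ≡ true → c p ≢ c q

  proper? : ∀ {Y : Set} → DecidableEquality Y → (W : Fin n → Bool) →
    Decidable (λ (c : Vec Y n) → ProperOn W (lookup c))
  proper? _≟ʸ_ W c = all? λ p → all? λ q →
    (W p ≟ᵇ true) →-dec ((W q ≟ᵇ true) →-dec ((adj G p q ≟ᵇ true) →-dec ¬? (lookup c p ≟ʸ lookup c q)))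

  -- Colours are bounded on W only, so that the empty vertex set is 0-colourable.
  ColourableOn : (Fin n → Bool) → ℕ → Set
  ColourableOn W m = ∃ λ (c : Fin n → ℕ) → (∀ i → W i ≡ true → c i < m) × ProperOn W c

  ChromaticAtLeast : (Fin n → Bool) → ℕ → Set
  ChromaticAtLeast W k = ∀ m → m < k → ¬ ColourableOn W m

  colour-vertex : ∀ {W u k} → W u ≡ true →
    ∀ c → (∀ i → (W ─ u) i ≡ true → c i < k) → ProperOn (W ─ u) c →
    ∀ b → b < k → (∀ q → W q ≡ true → q ≢ u → adj G u q ≡ true → b ≢ c q) → ColourableOn W k
  colour-vertex {W} {u} {k} Wu c c<k proper b b<k b-free = c′ , c′<k , proper′
    where
    c′ : Fin n → ℕ
    c′ = updateAt c u (const b)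
    c′<k : ∀ i → W i ≡ true → c′ i < k
    c′<k i Wi with i ≟ u
    ... | yes refl rewrite updateAt-updates u {const b} c = b<k
    ... | no  i≢u  rewrite updateAt-minimal i u {const b} c i≢u = c<k i (∈─ {W} Wi i≢u)
    proper′ : ProperOn W c′
    proper′ p q Wp Wq pq with p ≟ u | q ≟ u
    ... | yes refl | yes refl = contradiction (trans (sym pq) (irrefl G p)) (λ ())
    ... | yes refl | no q≢u
      rewrite updateAt-updates u {const b} c | updateAt-minimal q u {const b} c q≢u = b-free q Wq q≢u pq
    ... | no p≢u | yes refl
      rewrite updateAt-updates u {const b} c | updateAt-minimal p u {const b} c p≢u =
        b-free p Wp p≢u (trans (adj-sym G q p) pq) ∘ sym
    ... | no p≢u | no q≢u
      rewrite updateAt-minimal p u {const b} c p≢u | updateAt-minimal q u {const b} c q≢u =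
        proper p q (∈─ {W} Wp p≢u) (∈─ {W} Wq q≢u) pq

  length-colours-∩N : ∀ (c : Fin n → ℕ) W u →
    length (map c (filterᵇ (W ∩N u) (allFin n))) ≡ degIn W u
  length-colours-∩N c W u =
    trans (length-map c (filterᵇ (W ∩N u) (allFin n))) (length-filterᵇ-allFin (W ∩N u))

  extend-colouring : ∀ {W u k} → W u ≡ true → degIn W u < k →
    ColourableOn (W ─ u) k → ColourableOn W k
  extend-colouring {W} {u} {k} Wu deg<k (c , c<k , proper)
    with free-colour k (map c (filterᵇ ((W ─ u) ∩N u) (allFin n)))
                       (≤-<-trans (≤-reflexive (length-colours-∩N c (W ─ u) u))
                                  (≤-<-trans (degIn-─ W u u) deg<k))
  ... | b , b<k , b∉ = colour-vertex Wu c c<k proper b b<k b-free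
    where
    b-free : ∀ q → W q ≡ true → q ≢ u → adj G u q ≡ true → b ≢ c q
    b-free q Wq q≢u uq refl =
      b∉ (∈-map⁺ c (∈-filter⁺ (T? ∘ ((W ─ u) ∩N u)) (∈-allFin q) (Equivalence.from T-≡ q∈)))
      where
      q∈ : ((W ─ u) ∩N u) q ≡ true
      q∈ rewrite ∈─ {W} Wq q≢u = uq

  colourable-if-degrees-below : ∀ {k} W → (∀ u → W u ≡ true → degIn W u < k) → ColourableOn W k
  colourable-if-degrees-below {k} W = greedy ∣ W ∣ W refl
    where
    greedy : ∀ s W → ∣ W ∣ ≡ s → (∀ u → W u ≡ true → degIn W u < k) → ColourableOn W k
    greedy s W size deg<k with any? (λ u → W u ≟ᵇ true)
    ... | no  empty =
      (λ _ → 0) , (λ i Wi → contradiction (i , Wi) empty) , (λ p q Wp → contradiction (p , Wp) empty)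
    greedy zero    W size deg<k | yes (u , Wu) = contradiction (trans (sym size) (∣∣-remove Wu)) 0≢1+n
    greedy (suc s) W size deg<k | yes (u , Wu) =
      extend-colouring Wu (deg<k u Wu) (greedy s (W ─ u) size′ deg<k′)
      where
      size′ : ∣ W ─ u ∣ ≡ s
      size′ = suc-injective (trans (sym (∣∣-remove Wu)) size)
      deg<k′ : ∀ v → (W ─ u) v ≡ true → degIn (W ─ u) v < k
      deg<k′ v v∈ = ≤-<-trans (degIn-─ W u v) (deg<k v (∧-≡-trueˡ v∈))

  high-degree-vertex : ∀ {W k} → ¬ ColourableOn W k → ∃ λ v → W v ≡ true × k ≤ degIn W v
  high-degree-vertex {W} {k} ¬col with any? (λ v → (W v ≟ᵇ true) ×-dec (k ≤? degIn W v))
  ... | yes found = found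
  ... | no  none  = contradiction (colourable-if-degrees-below W deg<k) ¬col
    where
    deg<k : ∀ u → W u ≡ true → degIn W u < k
    deg<k u Wu = ≰⇒> (λ k≤deg → none (u , Wu , k≤deg))

  ProperOn-⊆ : ∀ {Y : Set} {W W′} {c : Fin n → Y} →
    (∀ i → W′ i ≡ true → W i ≡ true) → ProperOn W c → ProperOn W′ c
  ProperOn-⊆ W′⊆W proper p q W′p W′q = proper p q (W′⊆W p W′p) (W′⊆W q W′q)

  nonNeighbours : (Fin n → Bool) → Fin n → Fin n → Bool
  nonNeighbours U v i = (U ─ v) i ∧ not (adj G v i)

  ∣∣-around : ∀ {U v} → U v ≡ true → ∣ U ∣ ≡ suc (degIn U v + ∣ nonNeighbours U v ∣)
  ∣∣-around {U} {v} Uv = begin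
    ∣ U ∣
      ≡⟨ sum-cong-≗ split ⟩
    sum (λ i → 𝟙 (does (i ≟ v)) + (𝟙 ((U ∩N v) i) + 𝟙 (nonNeighbours U v i)))
      ≡⟨ ∑-distrib-+ (λ i → 𝟙 (does (i ≟ v))) _ ⟩
    sum (λ i → 𝟙 (does (i ≟ v))) + sum (λ i → 𝟙 ((U ∩N v) i) + 𝟙 (nonNeighbours U v i))
      ≡⟨ cong₂ _+_ (sum-𝟙-≟ v) (∑-distrib-+ (λ i → 𝟙 ((U ∩N v) i)) _) ⟩
    suc (degIn U v + ∣ nonNeighbours U v ∣) ∎
    where
    open ≡-Reasoning
    split : ∀ i → 𝟙 (U i) ≡ 𝟙 (does (i ≟ v)) + (𝟙 ((U ∩N v) i) + 𝟙 (nonNeighbours U v i))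
    split i with i ≟ v
    ... | yes refl rewrite Uv | irrefl G i = refl
    ... | no  _    with U i | adj G v i
    ...   | true  | true  = refl
    ...   | true  | false = refl
    ...   | false | _     = refl

  -- Counting list colourings

  module _ {X : Set} (_≟ˣ_ : DecidableEquality X) where

    -- Colourings of W from the list L; a vertex i outside W is frozen to the colour d i.
    listsOn : (Fin n → Bool) → List X → (Fin n → X) → Fin n → List X
    listsOn W L d i = if W i then L else d i ∷ []

    colouringsOn : (Fin n → Bool) → List X → (Fin n → X) → ℕ
    colouringsOn W L d = count (listsOn W L d) (proper? _≟ˣ_ W)

    ColouringBound : ℕ → Set
    ColouringBound k = ∀ W L d → ChromaticAtLeast W k →
      colouringsOn W L d ≤ (length L ↓ k) * length L ^ (∣ W ∣ ∸ k)

    colouring-bound-zero : ColouringBound 0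
    colouring-bound-zero W L d _ = begin
      colouringsOn W L d                          ≤⟨ count-≤-product (listsOn W L d) (proper? _≟ˣ_ W) ⟩
      product (λ i → length (listsOn W L d i))   ≡⟨ product-cong-≗ length-listsOn ⟩
      product (λ i → length L ^ 𝟙 (W i))         ≡⟨ product-^ (length L) (λ i → 𝟙 (W i)) ⟩
      length L ^ ∣ W ∣                            ≡⟨ sym (+-identityʳ _) ⟩
      1 * length L ^ ∣ W ∣                        ∎
      where
      open ≤-Reasoning
      length-listsOn : ∀ i → length (listsOn W L d i) ≡ length L ^ 𝟙 (W i)
      length-listsOn i with W i
      ... | true  = sym (*-identityʳ (length L))
      ... | false = refl

    -- The centre v gets the entry a of L₁ ++ a ∷ L₂. A vector t : Vec Bool n marks the vertices that
    -- take the same entry (vertices outside U take their default colour instead); unmarked vertices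
    -- choose from L₁ ++ L₂, see `parts`.
    module CentreColour (k : ℕ) (bound : ColouringBound k) {U : Fin n → Bool} {v : Fin n}
      (Uv : U v ≡ true) (k≤deg : k ≤ degIn U v) (χU : ChromaticAtLeast U (suc k))
      (d : Fin n → X) (L₁ : List X) (a : X) (L₂ : List X) where

      z : ℕ
      z = length (L₁ ++ L₂)

      before after : Fin n → List X
      before i = if (U ─ v) i then L₁ else []
      after  i = if (U ─ v) i then L₂ else []

      centre : Fin n → X
      centre i = if U i then a else d i

      pinned : Fin n → List X
      pinned = updateAt (listsOn U (L₁ ++ a ∷ L₂) d) v (const (a ∷ []))

      pinned-parts : ∀ i → pinned i ≡ before i ++ centre i ∷ after i
      pinned-parts i with i ≟ v
      ... | yes refl
        rewrite updateAt-updates i {const (a ∷ [])} (listsOn U (L₁ ++ a ∷ L₂) d)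
              | ∧-zeroʳ (U i) | Uv = refl
      ... | no i≢v
        rewrite updateAt-minimal i v {const (a ∷ [])} (listsOn U (L₁ ++ a ∷ L₂) d) i≢v
              | ∧-identityʳ (U i)
        with U i
      ...   | true  = refl
      ...   | false = refl

      -- v and the vertices outside U must be marked, the neighbours of v must not be, and the other
      -- vertices of U may be, at a cost of a factor z when unmarked.
      weight : Fin n → Bool → ℕ
      weight i b = if (U ─ v) i then (if adj G v i then 𝟙 (not b) else (if b then 1 else z))
                                  else 𝟙 b

      weight-sum : ∀ i → sumMap (weight i) (true ∷ false ∷ []) ≡ suc z ^ 𝟙 (nonNeighbours U v i)
      weight-sum i with (U ─ v) i | adj G v i
      ... | true  | true  = refl
      ... | true  | false = trans (cong suc (+-identityʳ z)) (sym (*-identityʳ (suc z)))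
      ... | false | _     = refl

      K : ℕ
      K = (z ↓ k) * z ^ (degIn U v ∸ k)

      module Part (t : Vec Bool n) where

        Ut : Fin n → Bool
        Ut i = U i ∧ not (lookup t i)

        Rt : Fin n → Bool
        Rt i = nonNeighbours U v i ∧ not (lookup t i)

        Ut-∋ : ∀ {i} → U i ≡ true → lookup t i ≡ false → Ut i ≡ true
        Ut-∋ Ui ti rewrite Ui | ti = refl

        module Witness (c : Vec X n) (c∈ : ∀ i → lookup c i ∈ parts before centre after t i)
                       (proper : ProperOn U (lookup c)) where

          c∈-unmarked : ∀ i → lookup t i ≡ false → lookup c i ∈ before i ++ after i
          c∈-unmarked i ti = subst (λ b → lookup c i ∈ (if b then centre i ∷ [] else before i ++ after i))
                              ti (c∈ i)

          c≡centre : ∀ i → lookup t i ≡ true → lookup c i ≡ centre i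
          c≡centre i ti
            with subst (λ b → lookup c i ∈ (if b then centre i ∷ [] else before i ++ after i)) ti (c∈ i)
          ... | here c≡ = c≡

          marked-outside : ∀ i → (U ─ v) i ≡ false → lookup t i ≡ true
          marked-outside i U′i with lookup t i in ti
          ... | true  = refl
          ... | false
            with subst (λ b → lookup c i ∈ (if b then L₁ else []) ++ (if b then L₂ else [])) U′i (c∈-unmarked i ti)
          ...   | ()

          coloured-a : ∀ i → lookup t i ≡ true → U i ≡ true → lookup c i ≡ a
          coloured-a i ti Ui = trans (c≡centre i ti) (cong (λ b → if b then a else d i) Ui)

          neighbour-unmarked : ∀ i → (U ─ v) i ≡ true → adj G v i ≡ true → lookup t i ≡ false
          neighbour-unmarked i U′i vi with lookup t i in ti
          ... | false = refl
          ... | true  = contradiction (trans (coloured-a v (marked-outside v (─-self {U} v)) Uv)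
                                             (sym (coloured-a i ti Ui)))
                                      (proper v i Uv Ui vi)
            where
            Ui : U i ≡ true
            Ui = ∧-≡-trueˡ U′i

          parts≗ : ∀ i → parts before centre after t i ≡ listsOn Ut (L₁ ++ L₂) centre i
          parts≗ i with lookup t i in ti
          ... | true  rewrite ∧-zeroʳ (U i) = refl
          ... | false with (U ─ v) i in U′i
          ...   | false = contradiction (trans (sym (marked-outside i U′i)) ti) λ ()
          ...   | true  = cong (λ b → if b ∧ true then L₁ ++ L₂ else centre i ∷ []) (sym (∧-≡-trueˡ U′i))

          weight≡ : ∀ i → weight i (lookup t i) ≡ z ^ 𝟙 (Rt i)
          weight≡ i with (U ─ v) i in U′i | adj G v i in vi | lookup t i in ti
          ... | false | _     | true  = refl
          ... | false | _     | false = contradiction (trans (sym (marked-outside i U′i)) ti) λ ()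
          ... | true  | true  | false = refl
          ... | true  | true  | true  = contradiction (trans (sym (neighbour-unmarked i U′i vi)) ti) λ ()
          ... | true  | false | true  = refl
          ... | true  | false | false = sym (*-identityʳ z)

          ∣Ut∣≡ : ∣ Ut ∣ ≡ degIn U v + ∣ Rt ∣
          ∣Ut∣≡ = trans (sum-cong-≗ split) (∑-distrib-+ (λ i → 𝟙 ((U ∩N v) i)) (λ i → 𝟙 (Rt i)))
            where
            split : ∀ i → 𝟙 (Ut i) ≡ 𝟙 ((U ∩N v) i) + 𝟙 (Rt i)
            split i with i ≟ v
            ... | yes refl rewrite Uv | irrefl G i | marked-outside i (─-self {U} v) = refl
            ... | no  i≢v with U i in Ui | adj G v i in vi | lookup t i in ti
            ...   | false | _     | _     = refl
            ...   | true  | true  | false = refl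
            ...   | true  | true  | true  =
              contradiction (trans (sym (neighbour-unmarked i (∈─ {U} Ui i≢v) vi)) ti) λ ()
            ...   | true  | false | true  = refl
            ...   | true  | false | false = refl

          -- The marked vertices of U, all coloured a, form one more colour class.
          χUt : ChromaticAtLeast Ut k
          χUt m m<k (c′ , c′<m , proper′) = χU (suc m) (s≤s m<k) (c″ , c″<1+m , proper″)
            where
            c″ : Fin n → ℕ
            c″ i = if lookup t i then 0 else suc (c′ i)
            c″<1+m : ∀ i → U i ≡ true → c″ i < suc m
            c″<1+m i Ui with lookup t i in ti
            ... | true  = s≤s z≤n
            ... | false = s≤s (c′<m i (Ut-∋ Ui ti))
            proper″ : ProperOn U c″
            proper″ p q Up Uq pq with lookup t p in tp | lookup t q in tq
            ... | true  | true  =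
              λ _ → proper p q Up Uq pq (trans (coloured-a p tp Up) (sym (coloured-a q tq Uq)))
            ... | true  | false = λ ()
            ... | false | true  = λ ()
            ... | false | false = proper′ p q (Ut-∋ Up tp) (Ut-∋ Uq tq) pq ∘ suc-injective

        part-bound : count (parts before centre after t) (proper? _≟ˣ_ U)
                     ≤ K * product (λ i → weight i (lookup t i))
        part-bound = count-≤-witness (parts before centre after t) (proper? _≟ˣ_ U) bound-from-witness
          where
          bound-from-witness : ∀ c → (∀ i → lookup c i ∈ parts before centre after t i) →
            ProperOn U (lookup c) →
            count (parts before centre after t) (proper? _≟ˣ_ U) ≤ K * product (λ i → weight i (lookup t i))
          bound-from-witness c c∈ proper = begin
            count (parts before centre after t) (proper? _≟ˣ_ U)
              ≡⟨ sumΠ-cong _ parts≗ ⟩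
            count (listsOn Ut (L₁ ++ L₂) centre) (proper? _≟ˣ_ U)
              ≤⟨ count-mono-≤ (listsOn Ut (L₁ ++ L₂) centre) (proper? _≟ˣ_ U) (proper? _≟ˣ_ Ut)
                              (ProperOn-⊆ (λ i → ∧-≡-trueˡ)) ⟩
            colouringsOn Ut (L₁ ++ L₂) centre
              ≤⟨ bound Ut (L₁ ++ L₂) centre χUt ⟩
            (z ↓ k) * z ^ (∣ Ut ∣ ∸ k)
              ≡⟨ cong (λ e → (z ↓ k) * z ^ e) (trans (cong (_∸ k) ∣Ut∣≡) (+-∸-comm ∣ Rt ∣ k≤deg)) ⟩
            (z ↓ k) * z ^ ((degIn U v ∸ k) + ∣ Rt ∣)
              ≡⟨ cong ((z ↓ k) *_) (^-distribˡ-+-* z (degIn U v ∸ k) ∣ Rt ∣) ⟩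
            (z ↓ k) * (z ^ (degIn U v ∸ k) * z ^ ∣ Rt ∣)
              ≡⟨ sym (*-assoc (z ↓ k) _ _) ⟩
            K * z ^ ∣ Rt ∣
              ≡⟨ cong (K *_) (sym (trans (product-cong-≗ weight≡) (product-^ z (λ i → 𝟙 (Rt i))))) ⟩
            K * product (λ i → weight i (lookup t i)) ∎
            where
            open ≤-Reasoning
            open Witness c c∈ proper

      centre-bound : count pinned (proper? _≟ˣ_ U) ≤ K * suc z ^ ∣ nonNeighbours U v ∣
      centre-bound = begin
        count pinned (proper? _≟ˣ_ U)
          ≡⟨ sumΠ-parts pinned before after centre _ pinned-parts ⟩
        sumΠ 𝔹 (λ t → count (parts before centre after t) (proper? _≟ˣ_ U))
          ≤⟨ sumΠ-mono-≤ 𝔹 Part.part-bound ⟩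
        sumΠ 𝔹 (λ t → K * product (λ i → weight i (lookup t i)))
          ≡⟨ sumΠ-*ˡ 𝔹 K _ ⟩
        K * sumΠ 𝔹 (λ t → product (λ i → weight i (lookup t i)))
          ≡⟨ cong (K *_) (sumΠ-product 𝔹 weight) ⟩
        K * product (λ i → sumMap (weight i) (true ∷ false ∷ []))
          ≡⟨ cong (K *_) (trans (product-cong-≗ weight-sum)
                                (product-^ (suc z) (λ i → 𝟙 (nonNeighbours U v i)))) ⟩
        K * suc z ^ ∣ nonNeighbours U v ∣ ∎
        where
        open ≤-Reasoning
        𝔹 : Fin n → List Bool
        𝔹 _ = true ∷ false ∷ []

    colourings-≤-at-vertex : ∀ k → ColouringBound k → ∀ {U v} → U v ≡ true → k ≤ degIn U v →
      ChromaticAtLeast U (suc k) → ∀ L d →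
      colouringsOn U L d
      ≤ (length L ↓ suc k) * (length L ∸ 1) ^ (degIn U v ∸ k) * length L ^ ∣ nonNeighbours U v ∣
    colourings-≤-at-vertex k bound {U} {v} Uv k≤deg χU L d = begin
      colouringsOn U L d
        ≡⟨ sumΠ-pin (listsOn U L d) _ v ⟩
      sumMap pinned-count (listsOn U L d v)
        ≡⟨ cong (λ b → sumMap pinned-count (if b then L else d v ∷ [])) Uv ⟩
      sumMap pinned-count L
        ≤⟨ sumMap-≤-length-* L per-colour ⟩
      y * ((y ∸ 1) ↓ k * (y ∸ 1) ^ e * y ^ r)
        ≡⟨ sym (*-assoc y ((y ∸ 1) ↓ k * (y ∸ 1) ^ e) (y ^ r)) ⟩
      y * ((y ∸ 1) ↓ k * (y ∸ 1) ^ e) * y ^ r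
        ≡⟨ cong (_* y ^ r) (sym (*-assoc y ((y ∸ 1) ↓ k) ((y ∸ 1) ^ e))) ⟩
      y * (y ∸ 1) ↓ k * (y ∸ 1) ^ e * y ^ r
        ≡⟨ cong (λ f → f * (y ∸ 1) ^ e * y ^ r) (sym (↓-suc y k)) ⟩
      (y ↓ suc k) * (y ∸ 1) ^ e * y ^ r ∎
      where
      open ≤-Reasoning
      y = length L
      e = degIn U v ∸ k
      r = ∣ nonNeighbours U v ∣
      pinned-count : X → ℕ
      pinned-count a = count (updateAt (listsOn U L d) v (const (a ∷ []))) (proper? _≟ˣ_ U)
      per-colour : ∀ {a} → a ∈ L →
        pinned-count a ≤ ((length L ∸ 1) ↓ k) * (length L ∸ 1) ^ e * length L ^ r
      per-colour {a} a∈L with ∈-∃++ a∈L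
      ... | L₁ , L₂ , L≡ rewrite L≡ =
        subst (λ l → pinned-count′ ≤ ((l ∸ 1) ↓ k) * (l ∸ 1) ^ e * l ^ r) (sym (length-++-sucʳ L₁ a L₂))
              (CentreColour.centre-bound k bound Uv k≤deg χU d L₁ a L₂)
        where
        pinned-count′ : ℕ
        pinned-count′ = count (updateAt (listsOn U (L₁ ++ a ∷ L₂) d) v (const (a ∷ []))) (proper? _≟ˣ_ U)

    colouring-bound : ∀ k → ColouringBound k
    colouring-bound zero = colouring-bound-zero
    colouring-bound (suc k) W L d χW with high-degree-vertex (χW k ≤-refl)
    ... | v , Wv , k≤deg = begin
      colouringsOn W L d
        ≤⟨ colourings-≤-at-vertex k (colouring-bound k) Wv k≤deg χW L d ⟩
      (y ↓ suc k) * (y ∸ 1) ^ (degIn W v ∸ k) * y ^ r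
        ≤⟨ pred-base-≤ (y ↓ suc k) y (degIn W v ∸ k) r ⟩
      (y ↓ suc k) * y ^ ((degIn W v ∸ k) + r)
        ≡⟨ cong (λ m → (y ↓ suc k) * y ^ m)
                (sym (trans (cong (_∸ suc k) (∣∣-around Wv)) (+-∸-comm r k≤deg))) ⟩
      (y ↓ suc k) * y ^ (∣ W ∣ ∸ suc k) ∎
      where
      open ≤-Reasoning
      y = length L
      r = ∣ nonNeighbours W v ∣

  -- The whole graph

  full : Fin n → Bool
  full _ = true

  degIn-full : ∀ v → degIn full v ≡ deg G v
  degIn-full v = sym (length-filterᵇ-allFin (adj G v))

  ∣full∣ : ∣ full ∣ ≡ n
  ∣full∣ = sum-ones n
    where
    sum-ones : ∀ m → sum (λ (_ : Fin m) → 1) ≡ m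
    sum-ones zero    = refl
    sum-ones (suc m) = cong suc (sum-ones m)

  Δ-attained : Fin n → ∃ λ v → Δ G ≡ deg G v
  Δ-attained u with max-attained (deg G) (allFin n) (∈-allFin u)
  ... | v , _ , Δ≡deg[v] = v , Δ≡deg[v]

  deg-≤-Δ : ∀ u → deg G u ≤ Δ G
  deg-≤-Δ u = ≤-max (deg G) (allFin n) (∈-allFin u)

  chromatic-at-least : ∀ {k} → Chromatic G k → ChromaticAtLeast full k
  chromatic-at-least (_ , minimal) m m<k (c , c<m , proper) = minimal m m<k (c′ , proper′)
    where
    c′ : Fin n → Fin m
    c′ i = fromℕ< (c<m i refl)
    proper′ : IsProper G c′
    proper′ u v uv c′u≡c′v = proper u v refl refl uv
      (trans (sym (toℕ-fromℕ< (c<m u refl))) (trans (cong toℕ c′u≡c′v) (toℕ-fromℕ< (c<m v refl))))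

  properᵇ-sound : ∀ {x} (c : Vec (Fin x) n) → T (properᵇ G c) → ProperOn full (lookup c)
  properᵇ-sound c T-proper p q _ _ pq cp≡cq = entry-false (All.lookup all-entries entry∈)
    where
    entry : Fin n → Fin n → Bool
    entry u w = not (adj G u w ∧ ⌊ lookup c u ≟ lookup c w ⌋)
    all-entries : All T (concatMap (λ u → map (entry u) (allFin n)) (allFin n))
    all-entries = foldr-forcesᵇ (λ _ _ → Equivalence.to T-∧) true _ T-proper
    entry∈ : entry p q ∈ concatMap (λ u → map (entry u) (allFin n)) (allFin n)
    entry∈ = ∈-concat⁺′ (∈-map⁺ (entry p) (∈-allFin q))
                        (∈-map⁺ (λ u → map (entry u) (allFin n)) (∈-allFin p))
    entry-false : ¬ T (entry p q)
    entry-false with lookup c p ≟ lookup c q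
    ... | yes _   rewrite pq = λ ()
    ... | no  c≢c = contradiction cp≡cq c≢c

  π-≤-colouringsOn : ∀ x (d : Fin n → Fin x) → π G x ≤ colouringsOn _≟_ full (allFin x) d
  π-≤-colouringsOn x d = begin
    π G x                                          ≡⟨ length-filterᵇ (properᵇ G) (allColourings n x) ⟩
    sumMap (𝟙 ∘ properᵇ G) (allColourings n x)     ≡⟨ sumMap-allColourings n x (𝟙 ∘ properᵇ G) ⟩
    count (λ _ → allFin x) (T? ∘ properᵇ G)
      ≤⟨ count-mono-≤ (λ _ → allFin x) (T? ∘ properᵇ G) (proper? _≟_ full) (λ {c} → properᵇ-sound c) ⟩
    colouringsOn _≟_ full (allFin x) d             ∎
    where open ≤-Reasoning

  max-degree-vertex : ∀ {k} → Chromatic G (suc k) → ∃ λ v → degIn full v ≡ Δ G × k ≤ degIn full v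
  max-degree-vertex {k} χG with high-degree-vertex (chromatic-at-least χG k ≤-refl)
  ... | u , _ , k≤deg[u] with Δ-attained u
  ...   | v , Δ≡deg[v] = v , degIn≡Δ , k≤deg[v]
    where
    degIn≡Δ : degIn full v ≡ Δ G
    degIn≡Δ = trans (degIn-full v) (sym Δ≡deg[v])
    k≤deg[v] : k ≤ degIn full v
    k≤deg[v] = begin
      k               ≤⟨ k≤deg[u] ⟩
      degIn full u    ≡⟨ degIn-full u ⟩
      deg G u         ≤⟨ deg-≤-Δ u ⟩
      Δ G             ≡⟨ degIn≡Δ ⟨
      degIn full v    ∎
      where open ≤-Reasoning

  ∣nonNeighbours-full∣ : ∀ v → ∣ nonNeighbours full v ∣ ≡ n ∸ 1 ∸ degIn full v
  ∣nonNeighbours-full∣ v = sym (begin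
    n ∸ 1 ∸ degIn full v
      ≡⟨ cong (λ m → m ∸ 1 ∸ degIn full v) (trans (sym ∣full∣) (∣∣-around refl)) ⟩
    degIn full v + ∣ nonNeighbours full v ∣ ∸ degIn full v
      ≡⟨ m+n∸m≡n (degIn full v) _ ⟩
    ∣ nonNeighbours full v ∣ ∎)
    where open ≡-Reasoning

theorem5 : (n k : ℕ) → 1 ≤ k → k ≤ n → (G : Graph n) → Chromatic G k →
    (x : ℕ) → π G x ≤ (x ↓ k) * ((x ∸ 1) ^ (Δ G ∸ (k ∸ 1))) * (x ^ (n ∸ 1 ∸ Δ G))
theorem5 (suc n) (suc k) _ _ G χG zero = z≤n
-- For x ≥ 1, the colour zero is the (never used) default colour of the vertices outside `full`.
theorem5 (suc n) (suc k) _ _ G χG (suc x) with GraphColouring.max-degree-vertex G χG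
... | v , degIn≡Δ , k≤deg = begin
  π G (suc x)
    ≤⟨ π-≤-colouringsOn (suc x) (λ _ → zero) ⟩
  colouringsOn _≟_ full (allFin (suc x)) (λ _ → zero)
    ≤⟨ colourings-≤-at-vertex _≟_ k (colouring-bound _≟_ k) refl k≤deg (chromatic-at-least χG)
                              (allFin (suc x)) (λ _ → zero) ⟩
  bound (length (allFin (suc x))) (degIn full v) ∣ nonNeighbours full v ∣
    ≡⟨ cong (λ y → bound y (degIn full v) ∣ nonNeighbours full v ∣) (length-tabulate (λ i → i)) ⟩
  bound (suc x) (degIn full v) ∣ nonNeighbours full v ∣
    ≡⟨ cong₂ (bound (suc x)) degIn≡Δ (trans (∣nonNeighbours-full∣ v) (cong (n ∸_) degIn≡Δ)) ⟩
  bound (suc x) (Δ G) (n ∸ Δ G) ∎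
  where
  open ≤-Reasoning
  open GraphColouring G
  bound : ℕ → ℕ → ℕ → ℕ
  bound y d r = (y ↓ suc k) * (y ∸ 1) ^ (d ∸ k) * y ^ r
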